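{- Consider interaction indices on products of finite chains defined as follows. For a finite index set $M$ with $|M|=m\geq1$, finite chains $(L_k)_{k\in M}$ (with bottoms $\bot_k$, tops $\top_k$), $L=\prod_{k\in M}L_k$ with the product order, a function $v:L\to\mathbb{R}$, a nonempty $J\subseteq M$ and $x\in L$ with $x_k=\bot_k$ for $k\notin J$ and $x_k\neq\bot_k$ for $k\in J$ (write $i_k:=x_k$ and $\underline{i_k}$ for its predecessor in $L_k$), set \[I^v(x):=\sum_{y}\alpha^{|J|}_{h(y)}(m)\,\Delta_x v(y),\] the sum running over all $y\in L$ with $y_k\in\{\bot_k,\top_k\}$ for $k\notin J$ and $y_k=\underline{i_k}$ for $k\in J$, where $\alpha^{j}_{h}(m)$ are real constants depending only on $m$, $j$ and $h$, $h(y)$ is the number of coordinates with $y_l=\top_l$, and $\Delta_x v(y):=\sum_{A\subseteq J}(-1)^{|J\setminus A|}v(y^A)$ with $y^A_k=i_k$ for $k\in A$ and $y^A_k=y_k$ otherwise. Suppose that for all such data (with $N$ denoting the index set $M$ and $n=|N|$) the recursion formula \[I^v(x)=I^{v^{[x]}}(\bot_{N\setminus J},\top_{[x]})-\sum_{K\subseteq J,\ K\neq\emptyset,J}I^{v^{N\setminus K}_x}(x_{|N\setminus K})\] holds, where: $v^{N\setminus K}_x:\prod_{k\in N\setminus K}L_k\to\mathbb{R}$ is given by $v^{N\setminus K}_x(y)=v(y')$ with $y'_k=\underline{i_k}$ for $k\in K$ and $y'_k=y_k$ otherwise; $x_{|N\setminus K}$ is the restriction of $x$ to the coordinates in $N\setminus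 K$; $v^{[x]}$ is the function on $\prod_{k\in N\setminus J}L_k\times\{\bot_{[x]},\top_{[x]}\}$ (a new coordinate $[x]$ carrying the two-element chain $\bot_{[x]}<\top_{[x]}$) given by $v^{[x]}(y)=v(y')$ with $y'_k=i_k$ if $k\in J$ and $y_{[x]}=\top_{[x]}$, $y'_k=\underline{i_k}$ if $k\in J$ and $y_{[x]}=\bot_{[x]}$, and $y'_k=y_k$ if $k\notin J$; and $(\bot_{N\setminus J},\top_{[x]})$ is the element of that domain with all coordinates bottom except the $[x]$-coordinate equal to $\top_{[x]}$. Then \[\alpha^j_k(n)=\alpha^1_k(n-j+1)\qquad\text{for all } j=1,\ldots,n,\ k=0,\ldots,n-j.\]
   Context: A chain is a totally ordered set; "predecessor" of a non-bottom element $a$ of a finite chain is the unique element covered by $a$. All interaction indices appearing in the recursion formula are computed with the same family of coefficients $\alpha^j_h(m)$, where $m$ is the number of coordinates of the domain of the function involved and $j$ is the number of non-bottom coordinates of the argument. -}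

module Defs where

open import Level using (Level)
open import Data.Bool using (Bool; true; false; not; _∧_; _∨_; if_then_else_)
open import Data.Nat using (ℕ; zero; suc; _∸_; _≡ᵇ_; _≤_)
open import Data.Fin using (Fin; zero; suc)
open import Data.List using (List; []; _∷_; concatMap; filterᵇ; map; foldr)
open import Data.Product using (Σ)
open import Function using (_∘_)
open import Relation.Nullary using (¬_)
open import Relation.Binary.PropositionalEquality using (_≡_)
open import Algebra.Bundles using (CommutativeRing)

-- Finite-set combinatorics on the index set Fin m.
-- A subset of Fin m is a characteristic function Fin m → Bool.

allBool : (m : ℕ) → List (Fin m → Bool)
allBool zero = (λ ()) ∷ []
allBool (suc m) =
  concatMap (λ f → (λ { zero → true ; (suc k) → f k })
                 ∷ (λ { zero → false ; (suc k) → f k }) ∷ [])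
            (allBool m)

allFin : {m : ℕ} → (Fin m → Bool) → Bool
allFin {zero} p = true
allFin {suc m} p = p zero ∧ allFin (p ∘ suc)

cntStep : Bool → ℕ → ℕ
cntStep true n = suc n
cntStep false n = n

cnt : {m : ℕ} → (Fin m → Bool) → ℕ
cnt {zero} s = zero
cnt {suc m} s = cntStep (s zero) (cnt (s ∘ suc))

-- restriction of a family z : Fin m → A to the coordinates in s,
-- reindexed increasingly by Fin (cnt s)
restrStep : {A : Set} {m n : ℕ} (b : Bool) →
            ((Fin m → A) → Fin n → A) →
            (Fin (suc m) → A) → Fin (cntStep b n) → A
restrStep true  rec z zero    = z zero
restrStep true  rec z (suc i) = rec (z ∘ suc) i
restrStep false rec z i       = rec (z ∘ suc) i

restr : {A : Set} {m : ℕ} (s : Fin m → Bool) → (Fin m → A) → Fin (cnt s) → A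
restr {m = zero}  s z ()
restr {m = suc m} s z = restrStep (s zero) (restr (s ∘ suc)) z

-- ins s y z : the family which on the coordinates in s is given by y
-- (in increasing order) and elsewhere by z
insStep : {A : Set} {m n : ℕ} (b : Bool) →
          ((Fin n → A) → (Fin m → A) → Fin m → A) →
          (Fin (cntStep b n) → A) → (Fin (suc m) → A) → Fin (suc m) → A
insStep true  rec y z zero    = y zero
insStep true  rec y z (suc k) = rec (y ∘ suc) (z ∘ suc) k
insStep false rec y z zero    = z zero
insStep false rec y z (suc k) = rec y (z ∘ suc) k

ins : {A : Set} {m : ℕ} (s : Fin m → Bool) →
      (Fin (cnt s) → A) → (Fin m → A) → Fin m → A
ins {m = zero}  s y z ()
ins {m = suc m} s y z = insStep (s zero) (ins (s ∘ suc)) y z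

-- A finite chain with ℓ+1 elements is {0 < 1 < … < ℓ} ⊆ ℕ: bottom 0,
-- top ℓ, predecessor of a non-bottom i is i ∸ 1.
-- A product of m chains is given by the sizes ℓ : Fin m → ℕ; its
-- elements are the x : Fin m → ℕ with x k ≤ ℓ k for all k.

InL : {m : ℕ} (ℓ : Fin m → ℕ) → (Fin m → ℕ) → Set
InL ℓ x = ∀ k → x k ≤ ℓ k

inJ : {m : ℕ} → (Fin m → ℕ) → Fin m → Bool
inJ x k = not (x k ≡ᵇ 0)

-- Interaction indices with coefficients α j h m  (= α^j_h(m)) in a
-- commutative ring (e.g. ℝ).

module Interaction {c ℓr : Level} (R : CommutativeRing c ℓr) where
  open CommutativeRing R using (Carrier; _+_; _*_; -_; _-_; 0#; 1#; _≈_)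

  sumR : List Carrier → Carrier
  sumR = foldr _+_ 0#

  sign : ℕ → Carrier
  sign zero = 1#
  sign (suc n) = - sign n

  Δ : (m : ℕ) → ((Fin m → ℕ) → Carrier) → (x y : Fin m → ℕ) → Carrier
  Δ m v x y =
    sumR (map (λ a → sign (cnt (λ k → inJ x k ∧ not (a k)))
                     * v (λ k → if a k then x k else y k))
              (filterᵇ (λ a → allFin (λ k → not (a k ∧ not (inJ x k))))
                       (allBool m)))

  -- the points y of the sum defining I^v(x), enumerated without repetition:
  -- b chooses ⊤_k (true) or ⊥_k (false) on coordinates k ∉ J whose chain
  -- has two distinct ends; on J, y_k is the predecessor of x_k.
  yOf : (m : ℕ) (ℓ : Fin m → ℕ) (x : Fin m → ℕ) (b : Fin m → Bool) → Fin m → ℕ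
  yOf m ℓ x b k = if inJ x k then x k ∸ 1 else (if b k then ℓ k else 0)

  validB : (m : ℕ) (ℓ : Fin m → ℕ) (x : Fin m → ℕ) (b : Fin m → Bool) → Bool
  validB m ℓ x b = allFin (λ k → not (b k ∧ (inJ x k ∨ (ℓ k ≡ᵇ 0))))

  hgt : (m : ℕ) (ℓ : Fin m → ℕ) (y : Fin m → ℕ) → ℕ
  hgt m ℓ y = cnt (λ k → y k ≡ᵇ ℓ k)

  I : (α : ℕ → ℕ → ℕ → Carrier) (m : ℕ) (ℓ : Fin m → ℕ)
      (v : (Fin m → ℕ) → Carrier) (x : Fin m → ℕ) → Carrier
  I α m ℓ v x =
    sumR (map (λ b → α (cnt (inJ x)) (hgt m ℓ (yOf m ℓ x b)) m
                     * Δ m v x (yOf m ℓ x b))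
              (filterᵇ (validB m ℓ x) (allBool m)))

  -- The right-hand side of the recursion formula.
  -- First term: domain (N∖J) plus a new coordinate [x], placed first
  -- (as coordinate zero) and carrying the two-element chain {0 < 1}.
  module _ (α : ℕ → ℕ → ℕ → Carrier) (m : ℕ) (ℓ : Fin m → ℕ)
           (v : (Fin m → ℕ) → Carrier) (x : Fin m → ℕ) where

    outJ : Fin m → Bool
    outJ k = not (inJ x k)

    ℓ[x] : Fin (suc (cnt outJ)) → ℕ
    ℓ[x] zero = 1
    ℓ[x] (suc i) = restr outJ ℓ i

    v[x] : (Fin (suc (cnt outJ)) → ℕ) → Carrier
    v[x] y = v (ins outJ (y ∘ suc)
                    (λ k → if y zero ≡ᵇ 0 then x k ∸ 1 else x k))

    bot-top : Fin (suc (cnt outJ)) → ℕ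
    bot-top zero = 1
    bot-top (suc i) = 0

    termK : (κ : Fin m → Bool) → Carrier
    termK κ =
      I α (cnt (not ∘ κ)) (restr (not ∘ κ) ℓ)
        (λ y → v (ins (not ∘ κ) y (λ k → x k ∸ 1)))
        (restr (not ∘ κ) x)

    properK : (κ : Fin m → Bool) → Bool
    properK κ = allFin (λ k → not (κ k ∧ not (inJ x k)))
                ∧ not (cnt κ ≡ᵇ 0)
                ∧ not (cnt κ ≡ᵇ cnt (inJ x))

    recursionRHS : Carrier
    recursionRHS =
      I α (suc (cnt outJ)) ℓ[x] v[x] bot-top
      - sumR (map termK (filterᵇ properK (allBool m)))

  RecursionHolds : (α : ℕ → ℕ → ℕ → Carrier) → Set _
  RecursionHolds α =
    (m : ℕ) (ℓ : Fin m → ℕ) (v : (Fin m → ℕ) → Carrier) (x : Fin m → ℕ) →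
    InL ℓ x → Σ (Fin m) (λ k → ¬ x k ≡ 0) →
    I α m ℓ v x ≈ recursionRHS α m ℓ v x

-- Let v be the indicator of x. A summand Δ_x v(y) of I^v(x) evaluates v only at points
-- agreeing with y off J, so it vanishes unless y is bottom off J, and then equals 1: hence
-- I^v(x) = α^{|J|}_h(n), where h counts the one-element chains off J. The function v^[x]
-- is again an indicator, of (⊥, ⊤_[x]), which has one non-bottom coordinate, n - |J| + 1
-- coordinates and the same h, so the first term of the recursion is α^1_h(n - |J| + 1);
-- every other term vanishes, since v^{N∖K}_x only evaluates v below x on K ≠ ∅.
-- Choosing chains for which h = k gives the theorem.
module Submission where

open import Defs
open import Level using (Level; _⊔_)
open import Data.Nat using (ℕ; _≤_; _∸_; _+_)
open import Algebra.Bundles using (CommutativeRing)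

open import Algebra.Properties.Ring using (-0#≈0#)
open import Data.Bool using (Bool; true; false; not; _∧_; _∨_; if_then_else_)
open import Data.Bool.Properties using (∧-conicalˡ; ∧-conicalʳ; ∧-inverseʳ; not-injective; not-¬; ¬-not; T-≡)
open import Data.Empty using (⊥-elim)
open import Data.Fin using (Fin; zero; suc)
open import Data.List using (List; []; _∷_; map; filterᵇ; concatMap)
open import Data.Nat using (zero; suc; _≡ᵇ_; _<_; z≤n; s≤s)
import Data.Nat.Properties as ℕ
open import Data.Product using (Σ; _×_; _,_; proj₁; proj₂)
open import Function using (_∘_)
open import Function.Bundles using (Equivalence)
open import Relation.Binary.PropositionalEquality as ≡
  using (_≡_; _≢_; _≗_; refl; cong; cong₂; subst₂)
import Relation.Binary.Reasoning.Setoid as SetoidReasoning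

≡ᵇ-true⇒≡ : ∀ m n → (m ≡ᵇ n) ≡ true → m ≡ n
≡ᵇ-true⇒≡ m n e = ℕ.≡ᵇ⇒≡ m n (Equivalence.from T-≡ e)

≡⇒≡ᵇ-true : ∀ {m n} → m ≡ n → (m ≡ᵇ n) ≡ true
≡⇒≡ᵇ-true {m} {n} e = Equivalence.to T-≡ (ℕ.≡⇒≡ᵇ m n e)

≢⇒≡ᵇ-false : ∀ {m n} → m ≢ n → (m ≡ᵇ n) ≡ false
≢⇒≡ᵇ-false {m} {n} m≢n = ¬-not (m≢n ∘ ≡ᵇ-true⇒≡ m n)

≡ᵇ-false⇒≢ : ∀ {m n} → (m ≡ᵇ n) ≡ false → m ≢ n
≡ᵇ-false⇒≢ e m≡n = not-¬ (≡⇒≡ᵇ-true m≡n) e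

pred<self : ∀ n → n ≢ 0 → n ∸ 1 < n
pred<self zero    n≢0 = ⊥-elim (n≢0 refl)
pred<self (suc n) _   = ℕ.n<1+n n

pred≢self : ∀ {n} → n ≢ 0 → n ∸ 1 ≢ n
pred≢self {n} n≢0 = ℕ.<⇒≢ (pred<self n n≢0)

-- not (a ∧ not b) is the Boolean implication a ⇒ b, the form in which Defs states inclusions.

⇒ᵇ-refl : ∀ b → not (b ∧ not b) ≡ true
⇒ᵇ-refl true  = refl
⇒ᵇ-refl false = refl

⇒ᵇ-false : ∀ {a b} → b ≡ false → not (a ∧ not b) ≡ true → a ≡ false
⇒ᵇ-false {false} refl _ = refl

⇒ᵇ-≢ : ∀ {a b} → not (a ∧ not b) ≡ true → a ≢ b → a ≡ false × b ≡ true
⇒ᵇ-≢ {false} {false} _ a≢b = ⊥-elim (a≢b refl)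
⇒ᵇ-≢ {false} {true}  _ _   = refl , refl
⇒ᵇ-≢ {true}  {true}  _ a≢b = ⊥-elim (a≢b refl)

⇒ᵇ-true : ∀ {a b} → not (a ∧ not b) ≡ true → a ≡ true → b ≡ true
⇒ᵇ-true {true} {true} _ _ = refl

nand-∨ : ∀ {b p q} → not (b ∧ (p ∨ q)) ≡ true → b ≡ true → p ≡ false × q ≡ false
nand-∨ {true} {false} {false} _ _ = refl , refl

-- Subsets of Fin m as characteristic functions

allFin-elim : ∀ {m} {p : Fin m → Bool} → allFin p ≡ true → ∀ i → p i ≡ true
allFin-elim {suc m} {p} e zero    = ∧-conicalˡ (p zero) _ e
allFin-elim {suc m} {p} e (suc i) = allFin-elim (∧-conicalʳ (p zero) _ e) i

allFin-intro : ∀ {m} {p : Fin m → Bool} → (∀ i → p i ≡ true) → allFin p ≡ true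
allFin-intro {zero}  h = refl
allFin-intro {suc m} h = cong₂ _∧_ (h zero) (allFin-intro (h ∘ suc))

cnt-cong : ∀ {m} {s t : Fin m → Bool} → s ≗ t → cnt s ≡ cnt t
cnt-cong {zero}  e = refl
cnt-cong {suc m} e = cong₂ cntStep (e zero) (cnt-cong (e ∘ suc))

cnt-const : ∀ m b → cnt {m} (λ _ → b) ≡ (if b then m else 0)
cnt-const zero    false = refl
cnt-const zero    true  = refl
cnt-const (suc m) false = cnt-const m false
cnt-const (suc m) true  = cong suc (cnt-const m true)

cnt≢0⇒member : ∀ {m} (s : Fin m → Bool) → cnt s ≢ 0 → Σ (Fin m) λ i → s i ≡ true
cnt≢0⇒member {zero}  s cnt≢0 = ⊥-elim (cnt≢0 refl)
cnt≢0⇒member {suc m} s cnt≢0 with s zero in s₀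
... | true  = zero , s₀
... | false with cnt≢0⇒member (s ∘ suc) cnt≢0
...   | i , sᵢ = suc i , sᵢ

cnt+cnt-not : ∀ {m} (s : Fin m → Bool) → cnt s + cnt (not ∘ s) ≡ m
cnt+cnt-not {zero}  s = refl
cnt+cnt-not {suc m} s with s zero
... | true  = cong suc (cnt+cnt-not (s ∘ suc))
... | false = ≡.trans (ℕ.+-suc _ _) (cong suc (cnt+cnt-not (s ∘ suc)))

cnt-not : ∀ {m} (s : Fin m → Bool) → cnt (not ∘ s) ≡ m ∸ cnt s
cnt-not {m} s = ≡.trans (≡.sym (ℕ.m+n∸m≡n (cnt s) _)) (cong (_∸ cnt s) (cnt+cnt-not s))

cnt-restr : ∀ {m} (P : ℕ → Bool) (s : Fin m → Bool) (z : Fin m → ℕ) →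
            cnt (λ i → P (restr s z i)) ≡ cnt (λ k → s k ∧ P (z k))
cnt-restr {zero}  P s z = refl
cnt-restr {suc m} P s z with s zero
... | true  = cong (cntStep (P (z zero))) (cnt-restr P (s ∘ suc) (z ∘ suc))
... | false = cnt-restr P (s ∘ suc) (z ∘ suc)

ins-false : ∀ {A : Set} {m} (s : Fin m → Bool) (y : Fin (cnt s) → A) (z : Fin m → A) k →
            s k ≡ false → ins s y z k ≡ z k
ins-false s y z zero sₖ with s zero
... | false = refl
ins-false s y z (suc k) sₖ with s zero
... | true  = ins-false (s ∘ suc) (y ∘ suc) (z ∘ suc) k sₖ
... | false = ins-false (s ∘ suc) y (z ∘ suc) k sₖ

ins-true : ∀ {A : Set} {m} (s : Fin m → Bool) (y : Fin (cnt s) → A) (z : Fin m → A) k →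
           s k ≡ true → Σ (Fin (cnt s)) λ i → ins s y z k ≡ y i
ins-true s y z zero sₖ with s zero
... | true = zero , refl
ins-true s y z (suc k) sₖ with s zero
... | true with ins-true (s ∘ suc) (y ∘ suc) (z ∘ suc) k sₖ
...   | i , e = suc i , e
ins-true s y z (suc k) sₖ | false = ins-true (s ∘ suc) y (z ∘ suc) k sₖ

ins-position : ∀ {A : Set} {m} (s : Fin m → Bool) (i : Fin (cnt s)) →
               Σ (Fin m) λ k → s k ≡ true × (∀ (y : Fin (cnt s) → A) z → ins s y z k ≡ y i)
ins-position {m = suc m} s i with s zero in s₀
ins-position {m = suc m} s zero    | true = zero , s₀ , λ y z → refl
ins-position {m = suc m} s (suc i) | true with ins-position (s ∘ suc) i
... | k , sₖ , eq = suc k , sₖ , λ y z → eq (y ∘ suc) (z ∘ suc)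
ins-position {m = suc m} s i | false with ins-position (s ∘ suc) i
... | k , sₖ , eq = suc k , sₖ , λ y z → eq y (z ∘ suc)

inJ-true⇒≢0 : ∀ {m} (x : Fin m → ℕ) k → inJ x k ≡ true → x k ≢ 0
inJ-true⇒≢0 x k Jₖ = ≡ᵇ-false⇒≢ (not-injective Jₖ)

inJ-false⇒≡0 : ∀ {m} (x : Fin m → ℕ) k → inJ x k ≡ false → x k ≡ 0
inJ-false⇒≡0 x k Jₖ = ≡ᵇ-true⇒≡ (x k) 0 (not-injective Jₖ)

replaceOn : ∀ {m} → (Fin m → Bool) → (x y : Fin m → ℕ) → Fin m → ℕ
replaceOn a x y k = if a k then x k else y k

replaceOn-InL : ∀ {m} {ℓ x y : Fin m → ℕ} (a : Fin m → Bool) → InL ℓ x → InL ℓ y →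
                InL ℓ (replaceOn a x y)
replaceOn-InL a x∈L y∈L k with a k
... | true  = x∈L k
... | false = y∈L k

⊆J : ∀ {m} → (Fin m → ℕ) → (Fin m → Bool) → Bool
⊆J x a = allFin (λ k → not (a k ∧ not (inJ x k)))

-- Interaction indices of indicator functions

module _ {c ℓr : Level} (R : CommutativeRing c ℓr) where
  open CommutativeRing R hiding (zero)
    renaming (_+_ to _⊕_; refl to ≈-refl; sym to ≈-sym; trans to ≈-trans)
  open Interaction R

  sumR-filter : ∀ {A : Set} (f : A → Carrier) (p : A → Bool) (xs : List A) →
                sumR (map f (filterᵇ p xs)) ≈ sumR (map (λ a → if p a then f a else 0#) xs)
  sumR-filter f p [] = ≈-refl
  sumR-filter f p (a ∷ xs) with p a
  ... | true  = +-congˡ (sumR-filter f p xs)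
  ... | false = ≈-trans (sumR-filter f p xs) (≈-sym (+-identityˡ _))

  sumR-zero : ∀ {A : Set} (f : A → Carrier) (xs : List A) → (∀ a → f a ≈ 0#) → sumR (map f xs) ≈ 0#
  sumR-zero f []       f≈0 = ≈-refl
  sumR-zero f (a ∷ xs) f≈0 = ≈-trans (+-cong (f≈0 a) (sumR-zero f xs f≈0)) (+-identityʳ 0#)

  sumR-pairs : ∀ {A B : Set} (g : B → Carrier) (h₁ h₂ : A → B) (xs : List A) →
               sumR (map g (concatMap (λ a → h₁ a ∷ h₂ a ∷ []) xs))
                 ≈ sumR (map (λ a → g (h₁ a) ⊕ g (h₂ a)) xs)
  sumR-pairs g h₁ h₂ []       = ≈-refl
  sumR-pairs g h₁ h₂ (a ∷ xs) = ≈-trans (≈-sym (+-assoc _ _ _)) (+-congˡ (sumR-pairs g h₁ h₂ xs))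

  sumR-allBool-point : ∀ {m} (t : Fin m → Bool) (g : (Fin m → Bool) → Carrier) {r : Carrier} →
                       (∀ b → b ≗ t → g b ≈ r) → (∀ b i → b i ≢ t i → g b ≈ 0#) →
                       sumR (map g (allBool m)) ≈ r
  sumR-allBool-point {zero} t g at off = ≈-trans (+-identityʳ _) (at _ λ ())
  sumR-allBool-point {suc m} t g {r} at off with t zero in t₀
  ... | true  = ≈-trans (sumR-pairs g _ _ (allBool m)) (sumR-allBool-point (t ∘ suc) _
                  (λ b b≗ → ≈-trans (+-cong (at _ λ { zero → ≡.sym t₀ ; (suc i) → b≗ i })
                                            (off _ zero (not-¬ t₀ ∘ ≡.sym)))
                                    (+-identityʳ r))
                  (λ b i b≢ → ≈-trans (+-cong (off _ (suc i) b≢) (off _ (suc i) b≢)) (+-identityʳ 0#)))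
  ... | false = ≈-trans (sumR-pairs g _ _ (allBool m)) (sumR-allBool-point (t ∘ suc) _
                  (λ b b≗ → ≈-trans (+-cong (off _ zero (not-¬ t₀ ∘ ≡.sym))
                                            (at _ λ { zero → ≡.sym t₀ ; (suc i) → b≗ i }))
                                    (+-identityˡ r))
                  (λ b i b≢ → ≈-trans (+-cong (off _ (suc i) b≢) (off _ (suc i) b≢)) (+-identityʳ 0#)))

  if-true : ∀ {p} {x y : Carrier} → p ≡ true → x ≈ y → (if p then x else 0#) ≈ y
  if-true refl x≈y = x≈y

  if-zero : ∀ p {x : Carrier} → (p ≡ true → x ≈ 0#) → (if p then x else 0#) ≈ 0#
  if-zero true  x≈0 = x≈0 refl
  if-zero false x≈0 = ≈-refl

  sumR-filter-zero : ∀ {A : Set} (f : A → Carrier) (p : A → Bool) (xs : List A) →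
                     (∀ a → p a ≡ true → f a ≈ 0#) → sumR (map f (filterᵇ p xs)) ≈ 0#
  sumR-filter-zero f p xs f≈0 =
    ≈-trans (sumR-filter f p xs) (sumR-zero _ xs λ a → if-zero (p a) (f≈0 a))

  sumR-filter-point : ∀ {m} (t : Fin m → Bool) (f : (Fin m → Bool) → Carrier) (p : (Fin m → Bool) → Bool)
                      {r : Carrier} → (∀ b → b ≗ t → p b ≡ true × f b ≈ r) →
                      (∀ b i → p b ≡ true → b i ≢ t i → f b ≈ 0#) →
                      sumR (map f (filterᵇ p (allBool m))) ≈ r
  sumR-filter-point t f p at off =
    ≈-trans (sumR-filter f p (allBool _))
            (sumR-allBool-point t _ (λ b b≗t → if-true (proj₁ (at b b≗t)) (proj₂ (at b b≗t)))
                                    (λ b i b≢t → if-zero (p b) λ pb → off b i pb b≢t))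

  -- Vanishing is asked for only on L: v^[x] sees its [x]-coordinate only through whether it is 0.
  record IsDirac {m} (ℓ : Fin m → ℕ) (v : (Fin m → ℕ) → Carrier) (x : Fin m → ℕ) : Set (c ⊔ ℓr) where
    field
      at-point  : ∀ z → z ≗ x → v z ≈ 1#
      off-point : ∀ z → InL ℓ z → ∀ k → z k ≢ x k → v z ≈ 0#

  dirac : ∀ {m} → (Fin m → ℕ) → (Fin m → ℕ) → Carrier
  dirac x z = if allFin (λ k → z k ≡ᵇ x k) then 1# else 0#

  dirac-at : ∀ {m} (x z : Fin m → ℕ) → z ≗ x → dirac x z ≈ 1#
  dirac-at x z z≗x = if-true (allFin-intro (≡⇒≡ᵇ-true ∘ z≗x)) ≈-refl

  dirac-off : ∀ {m} (x z : Fin m → ℕ) k → z k ≢ x k → dirac x z ≈ 0#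
  dirac-off x z k zₖ≢xₖ = if-zero (allFin (λ k → z k ≡ᵇ x k))
    λ z≡x → ⊥-elim (zₖ≢xₖ (≡ᵇ-true⇒≡ (z k) (x k) (allFin-elim z≡x k)))

  dirac-isDirac : ∀ {m} (ℓ x : Fin m → ℕ) → IsDirac ℓ (dirac x) x
  dirac-isDirac ℓ x = record { at-point = dirac-at x ; off-point = λ z _ → dirac-off x z }

  Δ-summand : ∀ {m} → ((Fin m → ℕ) → Carrier) → (x y : Fin m → ℕ) → (Fin m → Bool) → Carrier
  Δ-summand v x y a = sign (cnt (λ k → inJ x k ∧ not (a k))) * v (replaceOn a x y)

  I-summand : (α : ℕ → ℕ → ℕ → Carrier) (m : ℕ) (ℓ : Fin m → ℕ) (v : (Fin m → ℕ) → Carrier)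
              (x : Fin m → ℕ) → (Fin m → Bool) → Carrier
  I-summand α m ℓ v x b = α (cnt (inJ x)) (hgt m ℓ (yOf m ℓ x b)) m * Δ m v x (yOf m ℓ x b)

  yOf-InL : ∀ {m} {ℓ x : Fin m → ℕ} → InL ℓ x → ∀ b → InL ℓ (yOf m ℓ x b)
  yOf-InL {ℓ = ℓ} {x} x∈L b k with inJ x k | b k
  ... | true  | _     = ℕ.≤-trans (ℕ.m∸n≤m (x k) 1) (x∈L k)
  ... | false | true  = ℕ.≤-refl
  ... | false | false = z≤n

  yOf-J : ∀ {m} ℓ (x : Fin m → ℕ) b {k} → inJ x k ≡ true → yOf m ℓ x b k ≡ x k ∸ 1
  yOf-J ℓ x b {k} Jₖ = cong (λ β → if β then x k ∸ 1 else (if b k then ℓ k else 0)) Jₖ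

  yOf-off-J : ∀ {m} ℓ (x : Fin m → ℕ) b {k} → inJ x k ≡ false → yOf m ℓ x b k ≡ (if b k then ℓ k else 0)
  yOf-off-J ℓ x b {k} Jₖ = cong (λ β → if β then x k ∸ 1 else (if b k then ℓ k else 0)) Jₖ

  Δ-null : ∀ {m} {v : (Fin m → ℕ) → Carrier} → (∀ z → v z ≈ 0#) → ∀ x y → Δ m v x y ≈ 0#
  Δ-null {m} {v} v≈0 x y =
    sumR-filter-zero (Δ-summand v x y) (⊆J x) (allBool m) λ a _ → ≈-trans (*-congˡ (v≈0 _)) (zeroʳ _)

  Δ-dirac-one : ∀ {m} {ℓ x y : Fin m → ℕ} {v} → IsDirac ℓ v x → InL ℓ x → InL ℓ y →
                (∀ k → inJ x k ≡ true → y k ≢ x k) → (∀ k → inJ x k ≡ false → y k ≡ x k) →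
                Δ m v x y ≈ 1#
  Δ-dirac-one {m} {ℓ} {x} {y} {v} δ x∈L y∈L below agree =
    sumR-filter-point (inJ x) (Δ-summand v x y) (⊆J x) at off
    where
    open IsDirac δ
    replaceJ≗x : ∀ a → a ≗ inJ x → replaceOn a x y ≗ x
    replaceJ≗x a a≗ k with inJ x k in Jₖ | a≗ k
    ... | true  | aₖ = cong (λ β → if β then x k else y k) aₖ
    ... | false | aₖ = ≡.trans (cong (λ β → if β then x k else y k) aₖ) (agree k Jₖ)
    at : ∀ a → a ≗ inJ x → ⊆J x a ≡ true × Δ-summand v x y a ≈ 1#
    at a a≗ = allFin-intro (λ k → ≡.trans (cong (λ β → not (β ∧ not (inJ x k))) (a≗ k)) (⇒ᵇ-refl (inJ x k)))
            , ≈-trans (*-cong (reflexive (cong sign no-missing)) (at-point _ (replaceJ≗x a a≗))) (*-identityˡ 1#)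
      where
      no-missing : cnt (λ k → inJ x k ∧ not (a k)) ≡ 0
      no-missing = ≡.trans (cnt-cong λ k → ≡.trans (cong (λ β → inJ x k ∧ not β) (a≗ k)) (∧-inverseʳ (inJ x k)))
                           (cnt-const m false)
    off : ∀ a i → ⊆J x a ≡ true → a i ≢ inJ x i → Δ-summand v x y a ≈ 0#
    off a i a⊆J aᵢ≢ = ≈-trans (*-congˡ (off-point _ (replaceOn-InL a x∈L y∈L) i replaced≢)) (zeroʳ _)
      where
      aᵢ,Jᵢ = ⇒ᵇ-≢ (allFin-elim a⊆J i) aᵢ≢
      replaced≢ : replaceOn a x y i ≢ x i
      replaced≢ = ≡.subst (_≢ x i) (cong (λ β → if β then x i else y i) (≡.sym (proj₁ aᵢ,Jᵢ)))
                          (below i (proj₂ aᵢ,Jᵢ))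

  Δ-dirac-zero : ∀ {m} {ℓ x y : Fin m → ℕ} {v} → IsDirac ℓ v x → InL ℓ x → InL ℓ y →
                 ∀ i → inJ x i ≡ false → y i ≢ x i → Δ m v x y ≈ 0#
  Δ-dirac-zero {m} {ℓ} {x} {y} {v} δ x∈L y∈L i Jᵢ yᵢ≢xᵢ =
    sumR-filter-zero (Δ-summand v x y) (⊆J x) (allBool m) λ a a⊆J →
      ≈-trans (*-congˡ (IsDirac.off-point δ _ (replaceOn-InL a x∈L y∈L) i (replaced≢ a a⊆J))) (zeroʳ _)
    where
    replaced≢ : ∀ a → ⊆J x a ≡ true → replaceOn a x y i ≢ x i
    replaced≢ a a⊆J = ≡.subst (_≢ x i) (cong (λ β → if β then x i else y i)
                                             (≡.sym (⇒ᵇ-false Jᵢ (allFin-elim a⊆J i)))) yᵢ≢xᵢ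

  I-null : ∀ α m ℓ {v : (Fin m → ℕ) → Carrier} → (∀ z → v z ≈ 0#) → ∀ x → I α m ℓ v x ≈ 0#
  I-null α m ℓ {v} v≈0 x = sumR-filter-zero (I-summand α m ℓ v x) (validB m ℓ x) (allBool m)
    λ b _ → ≈-trans (*-congˡ (Δ-null v≈0 x _)) (zeroʳ _)

  I-dirac : ∀ α {m} {ℓ x : Fin m → ℕ} {v} → IsDirac ℓ v x → InL ℓ x →
            I α m ℓ v x ≈ α (cnt (inJ x)) (hgt m ℓ (yOf m ℓ x (λ _ → false))) m
  I-dirac α {m} {ℓ} {x} {v} δ x∈L =
    sumR-filter-point (λ _ → false) (I-summand α m ℓ v x) (validB m ℓ x) at off
    where
    at : ∀ b → b ≗ (λ _ → false) →
         validB m ℓ x b ≡ true × I-summand α m ℓ v x b ≈ α (cnt (inJ x)) (hgt m ℓ (yOf m ℓ x (λ _ → false))) m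
    at b b≗ = allFin-intro (λ k → cong (λ β → not (β ∧ (inJ x k ∨ (ℓ k ≡ᵇ 0)))) (b≗ k))
            , ≈-trans (*-cong (reflexive (cong (λ h → α (cnt (inJ x)) h m) same-height))
                              (Δ-dirac-one δ x∈L (yOf-InL x∈L b) below agree))
                      (*-identityʳ _)
      where
      same-height : hgt m ℓ (yOf m ℓ x b) ≡ hgt m ℓ (yOf m ℓ x (λ _ → false))
      same-height = cnt-cong λ k →
        cong (λ β → (if inJ x k then x k ∸ 1 else (if β then ℓ k else 0)) ≡ᵇ ℓ k) (b≗ k)
      below : ∀ k → inJ x k ≡ true → yOf m ℓ x b k ≢ x k
      below k Jₖ = ≡.subst (_≢ x k) (≡.sym (yOf-J ℓ x b Jₖ)) (pred≢self (inJ-true⇒≢0 x k Jₖ))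
      agree : ∀ k → inJ x k ≡ false → yOf m ℓ x b k ≡ x k
      agree k Jₖ = let open ≡.≡-Reasoning in begin
        yOf m ℓ x b k            ≡⟨ yOf-off-J ℓ x b Jₖ ⟩
        (if b k then ℓ k else 0) ≡⟨ cong (λ β → if β then ℓ k else 0) (b≗ k) ⟩
        0                        ≡⟨ inJ-false⇒≡0 x k Jₖ ⟨
        x k                      ∎
    off : ∀ b i → validB m ℓ x b ≡ true → b i ≢ false → I-summand α m ℓ v x b ≈ 0#
    off b i valid bᵢ≢false = ≈-trans (*-congˡ (Δ-dirac-zero δ x∈L (yOf-InL x∈L b) i Jᵢ top≢x)) (zeroʳ _)
      where
      bᵢ = ¬-not bᵢ≢false
      Jᵢ = proj₁ (nand-∨ (allFin-elim valid i) bᵢ)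
      ℓᵢ≢0 = ≡ᵇ-false⇒≢ (proj₂ (nand-∨ (allFin-elim valid i) bᵢ))
      top≢x : yOf m ℓ x b i ≢ x i
      top≢x yᵢ≡xᵢ = ℓᵢ≢0 (let open ≡.≡-Reasoning in begin
        ℓ i                      ≡⟨ cong (λ β → if β then ℓ i else 0) bᵢ ⟨
        (if b i then ℓ i else 0) ≡⟨ yOf-off-J ℓ x b Jᵢ ⟨
        yOf m ℓ x b i            ≡⟨ yᵢ≡xᵢ ⟩
        x i                      ≡⟨ inJ-false⇒≡0 x i Jᵢ ⟩
        0                        ∎)

  v[x]-isDirac : ∀ α {m} (ℓ x : Fin m → ℕ) → Σ (Fin m) (λ k → x k ≢ 0) →
                 IsDirac (ℓ[x] α m ℓ (dirac x) x) (v[x] α m ℓ (dirac x) x) (bot-top α m ℓ (dirac x) x)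
  v[x]-isDirac α {m} ℓ x (k₀ , xₖ₀≢0) = record { at-point = at ; off-point = off }
    where
    O : Fin m → Bool
    O k = not (inJ x k)
    base : (Fin (suc (cnt O)) → ℕ) → Fin m → ℕ
    base z k = if z zero ≡ᵇ 0 then x k ∸ 1 else x k
    embed : (Fin (suc (cnt O)) → ℕ) → Fin m → ℕ
    embed z = ins O (z ∘ suc) (base z)
    outside-J : ∀ {k} → O k ≡ true → x k ≡ 0
    outside-J {k} Oₖ = inJ-false⇒≡0 x k (not-injective Oₖ)
    at : ∀ z → z ≗ bot-top α m ℓ (dirac x) x → dirac x (embed z) ≈ 1#
    at z z≗ = dirac-at x (embed z) embed≗x
      where
      embed≗x : embed z ≗ x
      embed≗x k with O k in Oₖ
      ... | false = ≡.trans (ins-false O (z ∘ suc) (base z) k Oₖ)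
                            (cong (λ t → if t ≡ᵇ 0 then x k ∸ 1 else x k) (z≗ zero))
      ... | true with ins-true O (z ∘ suc) (base z) k Oₖ
      ...   | i , eq = ≡.trans eq (≡.trans (z≗ (suc i)) (≡.sym (outside-J Oₖ)))
    off : ∀ z → InL (ℓ[x] α m ℓ (dirac x) x) z → ∀ r → z r ≢ bot-top α m ℓ (dirac x) x r →
          dirac x (embed z) ≈ 0#
    off z z∈L zero z₀≢1 = dirac-off x (embed z) k₀ (≡.subst (_≢ x k₀) (≡.sym embed≡pred) (pred≢self xₖ₀≢0))
      where
      embed≡pred : embed z k₀ ≡ x k₀ ∸ 1
      embed≡pred = ≡.trans (ins-false O (z ∘ suc) (base z) k₀ (cong not (cong not (≢⇒≡ᵇ-false xₖ₀≢0))))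
                           (cong (λ t → if t ≡ᵇ 0 then x k₀ ∸ 1 else x k₀)
                                 (ℕ.n<1⇒n≡0 (ℕ.≤∧≢⇒< (z∈L zero) z₀≢1)))
    off z z∈L (suc i) zᵢ≢0 with ins-position O i
    ... | k , Oₖ , eq = dirac-off x (embed z) k λ embedₖ≡xₖ →
      zᵢ≢0 (≡.trans (≡.sym (eq (z ∘ suc) (base z))) (≡.trans embedₖ≡xₖ (outside-J Oₖ)))

  properK-sum-dirac : ∀ α {m} (ℓ x : Fin m → ℕ) →
                      sumR (map (termK α m ℓ (dirac x) x) (filterᵇ (properK α m ℓ (dirac x) x) (allBool m))) ≈ 0#
  properK-sum-dirac α {m} ℓ x =
    sumR-filter-zero (termK α m ℓ (dirac x) x) (properK α m ℓ (dirac x) x) (allBool m)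
      λ κ proper → I-null α _ _ (vanishes κ proper) _
    where
    vanishes : ∀ κ → properK α m ℓ (dirac x) x κ ≡ true → ∀ z → dirac x (ins (not ∘ κ) z (λ k → x k ∸ 1)) ≈ 0#
    vanishes κ proper z =
      dirac-off x (ins (not ∘ κ) z (λ k → x k ∸ 1)) i
        (≡.subst (_≢ x i) (≡.sym (ins-false (not ∘ κ) z (λ k → x k ∸ 1) i (cong not κᵢ)))
                 (pred≢self (inJ-true⇒≢0 x i Jᵢ)))
      where
      K⊆J = ∧-conicalˡ (⊆J x κ) _ proper
      K≢∅ = ∧-conicalˡ (not (cnt κ ≡ᵇ 0)) _ (∧-conicalʳ (⊆J x κ) _ proper)
      i,κᵢ = cnt≢0⇒member κ (≡ᵇ-false⇒≢ (not-injective K≢∅))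
      i = proj₁ i,κᵢ
      κᵢ = proj₂ i,κᵢ
      Jᵢ = ⇒ᵇ-true (allFin-elim K⊆J i) κᵢ

  hgt-bot-top : ∀ α {m} (ℓ : Fin m → ℕ) v (x : Fin m → ℕ) → InL ℓ x →
                let ℓ′ = ℓ[x] α m ℓ v x in
                hgt _ ℓ′ (yOf _ ℓ′ (bot-top α m ℓ v x) (λ _ → false)) ≡ hgt m ℓ (yOf m ℓ x (λ _ → false))
  hgt-bot-top α ℓ v x x∈L = ≡.trans (cnt-restr (0 ≡ᵇ_) (outJ α _ ℓ v x) ℓ) (cnt-cong top-outside-J)
    where
    top-outside-J : ∀ k → (not (inJ x k) ∧ (0 ≡ᵇ ℓ k)) ≡ ((if inJ x k then x k ∸ 1 else 0) ≡ᵇ ℓ k)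
    top-outside-J k with inJ x k in Jₖ
    ... | true  = ≡.sym (≢⇒≡ᵇ-false (ℕ.<⇒≢ (ℕ.<-≤-trans (pred<self (x k) (inJ-true⇒≢0 x k Jₖ)) (x∈L k))))
    ... | false = refl

  α-reduction : ∀ α → RecursionHolds α → ∀ {m} (ℓ x : Fin m → ℕ) → InL ℓ x → Σ (Fin m) (λ k → x k ≢ 0) →
                let h = hgt m ℓ (yOf m ℓ x (λ _ → false)) in
                α (cnt (inJ x)) h m ≈ α 1 h (m ∸ cnt (inJ x) + 1)
  α-reduction α recursion {m} ℓ x x∈L nonbottom = begin
    α (cnt (inJ x)) h m              ≈⟨ I-dirac α (dirac-isDirac ℓ x) x∈L ⟨
    I α m ℓ (dirac x) x              ≈⟨ recursion m ℓ (dirac x) x x∈L nonbottom ⟩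
    recursionRHS α m ℓ (dirac x) x   ≈⟨ +-congˡ (≈-trans (-‿cong (properK-sum-dirac α ℓ x)) (-0#≈0# ring)) ⟩
    I α m′ ℓ′ v′ ⊤′ ⊕ 0#             ≈⟨ +-identityʳ _ ⟩
    I α m′ ℓ′ v′ ⊤′                  ≈⟨ I-dirac α (v[x]-isDirac α ℓ x nonbottom) ⊤′∈L ⟩
    α (cnt (inJ ⊤′)) (hgt m′ ℓ′ (yOf m′ ℓ′ ⊤′ (λ _ → false))) m′
      ≡⟨ cong₂ (λ j h′ → α j h′ m′) single-nonbottom (hgt-bot-top α ℓ (dirac x) x x∈L) ⟩
    α 1 h m′                         ≡⟨ cong (α 1 h) (≡.trans (cong suc (cnt-not (inJ x))) (ℕ.+-comm 1 _)) ⟩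
    α 1 h (m ∸ cnt (inJ x) + 1)      ∎
    where
    open SetoidReasoning setoid
    h = hgt m ℓ (yOf m ℓ x (λ _ → false))
    m′ = suc (cnt (outJ α m ℓ (dirac x) x))
    ℓ′ = ℓ[x] α m ℓ (dirac x) x
    v′ = v[x] α m ℓ (dirac x) x
    ⊤′ = bot-top α m ℓ (dirac x) x
    single-nonbottom : cnt (inJ ⊤′) ≡ 1
    single-nonbottom = cong suc (cnt-const (cnt (outJ α m ℓ (dirac x) x)) false)
    ⊤′∈L : InL ℓ′ ⊤′
    ⊤′∈L zero    = ℕ.≤-refl
    ⊤′∈L (suc i) = z≤n

-- The witnessing product of chains

-- J is the set of active coordinates, and h counts the trivial (one-element) chains.
data Coordinate : Set where
  active trivial idle : Coordinate

top : Coordinate → ℕ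
top active  = 1
top trivial = 0
top idle    = 1

point : Coordinate → ℕ
point active  = 1
point trivial = 0
point idle    = 0

point≤top : ∀ c → point c ≤ top c
point≤top active  = s≤s z≤n
point≤top trivial = z≤n
point≤top idle    = z≤n

layout : (j k n : ℕ) → Fin n → Coordinate
layout (suc j) k       (suc n) zero    = active
layout (suc j) k       (suc n) (suc i) = layout j k n i
layout (suc j) k       zero    ()
layout zero    (suc k) (suc n) zero    = trivial
layout zero    (suc k) (suc n) (suc i) = layout zero k n i
layout zero    (suc k) zero    ()
layout zero    zero    n       i       = idle

cnt-layout-active : ∀ (p : Coordinate → Bool) → p active ≡ true → p trivial ≡ false → p idle ≡ false →
                    ∀ j k n → j ≤ n → cnt (p ∘ layout j k n) ≡ j
cnt-layout-active p pa pt pi (suc j) k (suc n) (s≤s j≤n) rewrite pa =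
  cong suc (cnt-layout-active p pa pt pi j k n j≤n)
cnt-layout-active p pa pt pi zero k n _ =
  ≡.trans (cnt-cong (none k n)) (cnt-const n false)
  where
  none : ∀ k n i → p (layout zero k n i) ≡ false
  none (suc k) (suc n) zero    = pt
  none (suc k) (suc n) (suc i) = none k n i
  none zero    n       i       = pi

cnt-layout-trivial : ∀ (p : Coordinate → Bool) → p active ≡ false → p trivial ≡ true → p idle ≡ false →
                     ∀ j k n → k ≤ n ∸ j → cnt (p ∘ layout j k n) ≡ k
cnt-layout-trivial p pa pt pi (suc j) k       (suc n) k≤ rewrite pa =
  cnt-layout-trivial p pa pt pi j k n k≤
cnt-layout-trivial p pa pt pi (suc j) zero    zero    _  = refl
cnt-layout-trivial p pa pt pi zero    (suc k) (suc n) (s≤s k≤n) rewrite pt =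
  cong suc (cnt-layout-trivial p pa pt pi zero k n k≤n)
cnt-layout-trivial p pa pt pi zero    zero    n       _  rewrite pi = cnt-const n false

theorem5 : {c ℓr : Level} (R : CommutativeRing c ℓr)
    (α : ℕ → ℕ → ℕ → CommutativeRing.Carrier R) →
    Interaction.RecursionHolds R α →
    (n j k : ℕ) → 1 ≤ j → j ≤ n → k ≤ n ∸ j →
    CommutativeRing._≈_ R (α j k n) (α 1 k (n ∸ j + 1))
theorem5 R α recursion n j k 1≤j j≤n k≤n∸j =
  subst₂ (λ j′ k′ → CommutativeRing._≈_ R (α j′ k′ n) (α 1 k′ (n ∸ j′ + 1))) #J #top
         (α-reduction R α recursion ℓ x x∈L nonbottom)
  where
  open Interaction R using (hgt; yOf)
  x ℓ : Fin n → ℕ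
  x = point ∘ layout j k n
  ℓ = top ∘ layout j k n
  x∈L : InL ℓ x
  x∈L = point≤top ∘ layout j k n
  #J : cnt (inJ x) ≡ j
  #J = cnt-layout-active (λ c → not (point c ≡ᵇ 0)) refl refl refl j k n j≤n
  #top : hgt n ℓ (yOf n ℓ x (λ _ → false)) ≡ k
  #top = cnt-layout-trivial (λ c → (if not (point c ≡ᵇ 0) then point c ∸ 1 else 0) ≡ᵇ top c)
                            refl refl refl j k n k≤n∸j
  nonbottom : Σ (Fin n) (λ i → x i ≢ 0)
  nonbottom with cnt≢0⇒member (inJ x) (≡.subst (_≢ 0) (≡.sym #J) (ℕ.>⇒≢ 1≤j))
  ... | i , Jᵢ = i , inJ-true⇒≢0 x i Jᵢ
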